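{- For every application context $C$ and every pattern $\varphi$, $\vdash_{\mathcal{MG}^c}C[\varphi]\to\lceil\varphi\rceil$.
   Context: Fix a countably infinite set $EVar$ of element variables and a set $\Sigma$ of constant symbols containing a distinguished "definedness symbol" $\lceil\,\rceil$. Patterns: $\varphi::= x\mid \sigma\mid \bot\mid \neg\varphi\mid \varphi\to\varphi\mid \varphi\wedge\varphi\mid\varphi\vee\varphi\mid \varphi\cdot\varphi\mid \forall x\varphi\mid\exists x\varphi$ ($\varphi\cdot\psi$ is application). Abbreviations: $\varphi\leftrightarrow\psi:=(\varphi\to\psi)\wedge(\psi\to\varphi)$, $\lceil\varphi\rceil:=\lceil\,\rceil\cdot\varphi$, $\lfloor\varphi\rfloor:=\neg\lceil\neg\varphi\rceil$, $\varphi=\psi:=\lfloor\varphi\leftrightarrow\psi\rfloor$. Application contexts are generated by $C::=\Box\mid C\cdot\chi\mid \chi\cdot C$ ($\chi$ a pattern); $C[\delta]$ is obtained by replacing $\Box$ by $\delta$. $\vdash\psi$ means there is a finite sequence ending in $\psi$ of axiom instances or consequences of earlier members by rules. Proof system $\mathcal{MG}^c$. Axioms: $\varphi\vee\varphi\to\varphi$; $\varphi\to\varphi\wedge\varphi$; $\varphi\to\varphi\vee\psi$; $\varphi\wedge\psi\to\varphi$; $\varphi\vee\psi\to\psi\vee\varphi$; $\varphi\wedge\psi\to\psi\wedge\varphi$; $\bot\to\varphi$; $\varphi\vee\neg\varphi$; $\neg\varphi\to(\varphi\to\bot)$; $(\varphi\to\bot)\to\neg\varphi$; $\forall x(\varphi\to\psi)\to(\forall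 x\varphi\to\forall x\psi)$; $\varphi\to\forall x\varphi$ if $x$ does not occur in $\varphi$; $\exists x(x=y)$ for $y$ distinct from $x$; $\exists x\varphi\to\neg\forall x\neg\varphi$; $\neg\forall x\neg\varphi\to\exists x\varphi$; $(\varphi\vee\psi)\cdot\chi\to\varphi\cdot\chi\vee\psi\cdot\chi$; $\chi\cdot(\varphi\vee\psi)\to\chi\cdot\varphi\vee\chi\cdot\psi$; $(\exists x\varphi)\cdot\psi\to\exists x(\varphi\cdot\psi)$ and $\psi\cdot(\exists x\varphi)\to\exists x(\psi\cdot\varphi)$ if $x$ does not occur in $\psi$; $\lceil\varphi\rceil\cdot\psi\to\lceil\varphi\rceil$; $\psi\cdot\lceil\varphi\rceil\to\lceil\varphi\rceil$; $\lceil x\rceil$; $\varphi\to\lceil\varphi\rceil$; $\lceil\bot\rceil\to\bot$. Rules: from $\varphi$, $\varphi\to\psi$ infer $\psi$; from $\varphi\to\psi$, $\psi\to\chi$ infer $\varphi\to\chi$; from $\varphi\wedge\psi\to\chi$ infer $\varphi\to(\psi\to\chi)$; from $\varphi\to(\psi\to\chi)$ infer $\varphi\wedge\psi\to\chi$; from $\varphi\to\psi$ infer $\chi\vee\varphi\to\chi\vee\psi$; from $\varphi$ infer $\forall x\varphi$; from $\varphi\to\psi$ infer $\varphi\cdot\chi\to\psi\cdot\chi$ and $\chi\cdot\varphi\to\chi\cdot\psi$. -}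

module Defs where

open import Data.Nat using (ℕ)
open import Relation.Binary.PropositionalEquality using (_≡_)
open import Relation.Nullary using (¬_)
open import Data.Sum using (_⊎_)

EVar : Set
EVar = ℕ

data Pattern (Sig : Set) : Set where
  var  : EVar → Pattern Sig
  sym  : Sig → Pattern Sig
  ⊥ₚ   : Pattern Sig
  ¬ₚ_  : Pattern Sig → Pattern Sig
  _⇒_  : Pattern Sig → Pattern Sig → Pattern Sig
  _∧ₚ_ : Pattern Sig → Pattern Sig → Pattern Sig
  _∨ₚ_ : Pattern Sig → Pattern Sig → Pattern Sig
  _·_  : Pattern Sig → Pattern Sig → Pattern Sig
  ∀ₚ   : EVar → Pattern Sig → Pattern Sig
  ∃ₚ   : EVar → Pattern Sig → Pattern Sig

infixr 5 _⇒_
infixl 7 _∧ₚ_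
infixl 6 _∨ₚ_
infixl 9 _·_
infix 8 ¬ₚ_

-- "x occurs in φ" (anywhere, including as a bound/binder variable).
data Occurs {Sig : Set} (x : EVar) : Pattern Sig → Set where
  o-var  : Occurs x (var x)
  o-¬    : ∀ {φ} → Occurs x φ → Occurs x (¬ₚ φ)
  o-⇒l   : ∀ {φ ψ} → Occurs x φ → Occurs x (φ ⇒ ψ)
  o-⇒r   : ∀ {φ ψ} → Occurs x ψ → Occurs x (φ ⇒ ψ)
  o-∧l   : ∀ {φ ψ} → Occurs x φ → Occurs x (φ ∧ₚ ψ)
  o-∧r   : ∀ {φ ψ} → Occurs x ψ → Occurs x (φ ∧ₚ ψ)
  o-∨l   : ∀ {φ ψ} → Occurs x φ → Occurs x (φ ∨ₚ ψ)
  o-∨r   : ∀ {φ ψ} → Occurs x ψ → Occurs x (φ ∨ₚ ψ)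
  o-·l   : ∀ {φ ψ} → Occurs x φ → Occurs x (φ · ψ)
  o-·r   : ∀ {φ ψ} → Occurs x ψ → Occurs x (φ · ψ)
  o-∀b   : ∀ {φ} → Occurs x (∀ₚ x φ)
  o-∀    : ∀ {y φ} → Occurs x φ → Occurs x (∀ₚ y φ)
  o-∃b   : ∀ {φ} → Occurs x (∃ₚ x φ)
  o-∃    : ∀ {y φ} → Occurs x φ → Occurs x (∃ₚ y φ)

module WithDefinedness {Sig : Set} (def : Sig) where

  P : Set
  P = Pattern Sig

  _⇔_ : P → P → P
  φ ⇔ ψ = (φ ⇒ ψ) ∧ₚ (ψ ⇒ φ)

  ⌈_⌉ : P → P
  ⌈ φ ⌉ = sym def · φ

  ⌊_⌋ : P → P
  ⌊ φ ⌋ = ¬ₚ ⌈ ¬ₚ φ ⌉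

  _≐_ : P → P → P
  φ ≐ ψ = ⌊ φ ⇔ ψ ⌋

  data AppCtx : Set where
    □    : AppCtx
    _·ᶜ_ : AppCtx → P → AppCtx
    _ᶜ·_ : P → AppCtx → AppCtx

  plug : AppCtx → P → P
  plug □ δ = δ
  plug (C ·ᶜ χ) δ = plug C δ · χ
  plug (χ ᶜ· C) δ = χ · plug C δ

  data ⊢_ : P → Set where
    ax-∨idem : ∀ φ → ⊢ (φ ∨ₚ φ ⇒ φ)
    ax-∧dup  : ∀ φ → ⊢ (φ ⇒ φ ∧ₚ φ)
    ax-∨intro : ∀ φ ψ → ⊢ (φ ⇒ φ ∨ₚ ψ)
    ax-∧elim : ∀ φ ψ → ⊢ (φ ∧ₚ ψ ⇒ φ)
    ax-∨comm : ∀ φ ψ → ⊢ (φ ∨ₚ ψ ⇒ ψ ∨ₚ φ)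
    ax-∧comm : ∀ φ ψ → ⊢ (φ ∧ₚ ψ ⇒ ψ ∧ₚ φ)
    ax-⊥     : ∀ φ → ⊢ (⊥ₚ ⇒ φ)
    ax-lem   : ∀ φ → ⊢ (φ ∨ₚ ¬ₚ φ)
    ax-¬⇒    : ∀ φ → ⊢ (¬ₚ φ ⇒ (φ ⇒ ⊥ₚ))
    ax-⇒¬    : ∀ φ → ⊢ ((φ ⇒ ⊥ₚ) ⇒ ¬ₚ φ)
    ax-∀K    : ∀ x φ ψ → ⊢ (∀ₚ x (φ ⇒ ψ) ⇒ (∀ₚ x φ ⇒ ∀ₚ x ψ))
    ax-∀vac  : ∀ x φ → ¬ Occurs x φ → ⊢ (φ ⇒ ∀ₚ x φ)
    ax-∃eq   : ∀ x y → ¬ (x ≡ y) → ⊢ (∃ₚ x (var x ≐ var y))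
    ax-∃→¬∀¬ : ∀ x φ → ⊢ (∃ₚ x φ ⇒ ¬ₚ ∀ₚ x (¬ₚ φ))
    ax-¬∀¬→∃ : ∀ x φ → ⊢ (¬ₚ ∀ₚ x (¬ₚ φ) ⇒ ∃ₚ x φ)
    ax-prop∨l : ∀ φ ψ χ → ⊢ ((φ ∨ₚ ψ) · χ ⇒ φ · χ ∨ₚ ψ · χ)
    ax-prop∨r : ∀ φ ψ χ → ⊢ (χ · (φ ∨ₚ ψ) ⇒ χ · φ ∨ₚ χ · ψ)
    ax-prop∃l : ∀ x φ ψ → ¬ Occurs x ψ → ⊢ ((∃ₚ x φ) · ψ ⇒ ∃ₚ x (φ · ψ))
    ax-prop∃r : ∀ x φ ψ → ¬ Occurs x ψ → ⊢ (ψ · (∃ₚ x φ) ⇒ ∃ₚ x (ψ · φ))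
    ax-⌈⌉l   : ∀ φ ψ → ⊢ (⌈ φ ⌉ · ψ ⇒ ⌈ φ ⌉)
    ax-⌈⌉r   : ∀ φ ψ → ⊢ (ψ · ⌈ φ ⌉ ⇒ ⌈ φ ⌉)
    ax-⌈x⌉   : ∀ x → ⊢ ⌈ var x ⌉
    ax-⌈⌉in  : ∀ φ → ⊢ (φ ⇒ ⌈ φ ⌉)
    ax-⌈⊥⌉   : ⊢ (⌈ ⊥ₚ ⌉ ⇒ ⊥ₚ)
    r-mp     : ∀ {φ ψ} → ⊢ φ → ⊢ (φ ⇒ ψ) → ⊢ ψ
    r-syll   : ∀ {φ ψ χ} → ⊢ (φ ⇒ ψ) → ⊢ (ψ ⇒ χ) → ⊢ (φ ⇒ χ)
    r-exp    : ∀ {φ ψ χ} → ⊢ (φ ∧ₚ ψ ⇒ χ) → ⊢ (φ ⇒ (ψ ⇒ χ))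
    r-imp    : ∀ {φ ψ χ} → ⊢ (φ ⇒ (ψ ⇒ χ)) → ⊢ (φ ∧ₚ ψ ⇒ χ)
    r-∨mono  : ∀ {φ ψ} χ → ⊢ (φ ⇒ ψ) → ⊢ (χ ∨ₚ φ ⇒ χ ∨ₚ ψ)
    r-gen    : ∀ {φ} x → ⊢ φ → ⊢ (∀ₚ x φ)
    r-framel : ∀ {φ ψ} χ → ⊢ (φ ⇒ ψ) → ⊢ (φ · χ ⇒ ψ · χ)
    r-framer : ∀ {φ ψ} χ → ⊢ (φ ⇒ ψ) → ⊢ (χ · φ ⇒ χ · ψ)

{-# OPTIONS --safe #-}
module Submission where

open import Defs

-- C[φ] → C[⌈φ⌉] by framing ⊢ φ → ⌈φ⌉ through C, and C[⌈φ⌉] → ⌈φ⌉ because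
-- a defined pattern absorbs application on either side, one layer of C at a time.

module ApplicationContexts {Sig : Set} (def : Sig) where

  open WithDefinedness def

  ⇒-refl : ∀ (φ : P) → ⊢ (φ ⇒ φ)
  ⇒-refl φ = r-syll (ax-∧dup φ) (ax-∧elim φ φ)

  plug-mono : ∀ (C : AppCtx) {φ ψ : P} → ⊢ (φ ⇒ ψ) → ⊢ (plug C φ ⇒ plug C ψ)
  plug-mono □        φ⇒ψ = φ⇒ψ
  plug-mono (C ·ᶜ χ) φ⇒ψ = r-framel χ (plug-mono C φ⇒ψ)
  plug-mono (χ ᶜ· C) φ⇒ψ = r-framer χ (plug-mono C φ⇒ψ)

  plug-⌈⌉-absorb : ∀ (C : AppCtx) (φ : P) → ⊢ (plug C ⌈ φ ⌉ ⇒ ⌈ φ ⌉)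
  plug-⌈⌉-absorb □        φ = ⇒-refl ⌈ φ ⌉
  plug-⌈⌉-absorb (C ·ᶜ χ) φ = r-syll (r-framel χ (plug-⌈⌉-absorb C φ)) (ax-⌈⌉l φ χ)
  plug-⌈⌉-absorb (χ ᶜ· C) φ = r-syll (r-framer χ (plug-⌈⌉-absorb C φ)) (ax-⌈⌉r φ χ)

mainTheorem16 : (Sig : Set) (def : Sig) →
    let open WithDefinedness def in
    (C : AppCtx) (φ : Pattern Sig) → ⊢ (plug C φ ⇒ ⌈ φ ⌉)
mainTheorem16 Sig def C φ =
  r-syll (plug-mono C (ax-⌈⌉in φ)) (plug-⌈⌉-absorb C φ)
  where
  open WithDefinedness def
  open ApplicationContexts def
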